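{- For every (non-empty) sequent $\Gamma$, the sequent $\vdash\Gamma$ is provable in $\mathsf{LK1}$ if and only if the formula $\bigvee\Gamma$ is provable in $\mathsf{KS1}$.
   Context: Formulas: terms $t::=x\mid f(t_1,\dots,t_n)$; atoms $a::=\mathsf t\mid\mathsf f\mid p(\vec t)\mid\bar p(\vec t)$ (each predicate $p$ has a dual $\bar p$, $\bar{\bar p}=p$); formulas $A::=a\mid A\wedge A\mid A\vee A\mid\exists x.A\mid\forall x.A$ in negation normal form, with negation $\bar{\mathsf t}=\mathsf f$, $\bar{\mathsf f}=\mathsf t$, $\overline{p(\vec t)}=\bar p(\vec t)$, $\overline{\bar p(\vec t)}=p(\vec t)$, De Morgan for the rest. A sequent $\Gamma$ is a finite multiset of formulas; for $\Gamma=A_1,\dots,A_n$ ($n\geq1$) its corresponding formula is $\bigvee\Gamma=A_1\vee\dots\vee A_n$. $\mathsf{LK1}$ has rules: $\mathsf{ax}$: $\vdash a,\bar a$; $\vee$: from $\vdash\Gamma,A,B$ infer $\vdash\Gamma,A\vee B$; $\wedge$: from $\vdash\Gamma,A$ and $\vdash B,\Delta$ infer $\vdash\Gamma,A\wedge B,\Delta$; $\mathsf t$: $\vdash\mathsf t$; $\mathsf f$: from $\vdash\Gamma$ infer $\vdash\Gamma,\mathsf f$; $\mathsf{mix}$: from $\vdash\Gamma$ and $\vdash\Delta$ infer $\vdash\Gamma,\Delta$; $\exists$: from $\vdash\Gamma,A[x/t]$ infer $\vdash\Gamma,\exists x.A$; $\forall$: from $\vdash\Gamma,A$ infer $\vdash\Gamma,\forall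 x.A$ if $x$ not free in $\Gamma$; $\mathsf{ctr}$: from $\vdash\Gamma,A,A$ infer $\vdash\Gamma,A$; $\mathsf{wk}$: from $\vdash\Gamma$ infer $\vdash\Gamma,A$. $\equiv$ is the smallest congruence on formulas with $\wedge,\vee$ commutative and associative, $\forall x\forall y.A\equiv\forall y\forall x.A$, $\exists x\exists y.A\equiv\exists y\exists x.A$, $\forall x.(A\vee B)\equiv(\forall x.A)\vee B$ and $\exists x.(A\wedge B)\equiv(\exists x.A)\wedge B$ for $x$ not free in $B$. A context $S\{\ \}$ is a formula with one hole in place of an atom. $\mathsf{KS1}$ has rules (premise $\Rightarrow$ conclusion in any context $S$): $\forall$: $S\{\mathsf t\}\Rightarrow S\{\forall x.\mathsf t\}$; $\mathsf{ai}$: $S\{\mathsf t\}\Rightarrow S\{a\vee\bar a\}$; $\mathsf t$-rule: $S\{A\}\Rightarrow S\{A\wedge\mathsf t\}$; $\mathsf s$: $S\{A\wedge(B\vee C)\}\Rightarrow S\{(A\wedge B)\vee C\}$; $\mathsf{mix}$: $S\{A\wedge B\}\Rightarrow S\{A\vee B\}$; $\exists$: $S\{A[x/t]\}\Rightarrow S\{\exists x.A\}$; $\equiv$: $S\{B\}\Rightarrow S\{A\}$ if $A\equiv B$; $\mathsf w$: $S\{A\}\Rightarrow S\{A\vee B\}$; $\mathsf m$: $S\{(A\wedge C)\vee(B\wedge D)\}\Rightarrow S\{(A\vee B)\wedge(C\vee D)\}$; $\mathsf{ac}$: $S\{a\vee a\}\Rightarrow S\{a\}$; $\mathsf m_\forall$: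 $S\{(\forall x.A)\vee(\forall x.B)\}\Rightarrow S\{\forall x.(A\vee B)\}$; $\mathsf m_\exists$: same with $\exists$; $\mathsf w_\forall$: $S\{A\}\Rightarrow S\{\forall x.A\}$ ($x$ not free in $A$); $\mathsf c_\forall$: $S\{\forall x.\forall x.A\}\Rightarrow S\{\forall x.A\}$. A formula is provable in $\mathsf{KS1}$ if there is a finite sequence of formulas from $\mathsf t$ to it, each step a rule instance. -}

module Defs where

open import Data.Nat using (ℕ; zero; suc)
open import Data.Bool using (Bool; true; false; not)
open import Data.List using (List; []; _∷_; _++_; map)
open import Data.List.Relation.Binary.Permutation.Propositional using (_↭_)
open import Relation.Binary.Construct.Closure.ReflexiveTransitive using (Star)

-- Terms (de Bruijn indices for variables; function symbols named by ℕ,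
-- applied to a list of arguments)

data Term : Set where
  var : ℕ → Term
  fun : ℕ → List Term → Term

ext : (ℕ → ℕ) → ℕ → ℕ
ext ρ zero    = zero
ext ρ (suc n) = suc (ρ n)

mutual
  renT : (ℕ → ℕ) → Term → Term
  renT ρ (var x)    = var (ρ x)
  renT ρ (fun f ts) = fun f (renTs ρ ts)

  renTs : (ℕ → ℕ) → List Term → List Term
  renTs ρ []       = []
  renTs ρ (t ∷ ts) = renT ρ t ∷ renTs ρ ts

exts : (ℕ → Term) → ℕ → Term
exts σ zero    = var zero
exts σ (suc n) = renT suc (σ n)

mutual
  subT : (ℕ → Term) → Term → Term
  subT σ (var x)    = σ x
  subT σ (fun f ts) = fun f (subTs σ ts)

  subTs : (ℕ → Term) → List Term → List Term
  subTs σ []       = []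
  subTs σ (t ∷ ts) = subT σ t ∷ subTs σ ts

-- Atoms: t, f, p(ts) and its dual p̄(ts) (polarity flag)

data Atom : Set where
  tt ff : Atom
  pred  : Bool → ℕ → List Term → Atom

dual : Atom → Atom
dual tt            = ff
dual ff            = tt
dual (pred b p ts) = pred (not b) p ts

renA : (ℕ → ℕ) → Atom → Atom
renA ρ tt            = tt
renA ρ ff            = ff
renA ρ (pred b p ts) = pred b p (renTs ρ ts)

subA : (ℕ → Term) → Atom → Atom
subA σ tt            = tt
subA σ ff            = ff
subA σ (pred b p ts) = pred b p (subTs σ ts)

-- Formulas in negation normal form; All / Ex bind de Bruijn index 0

infixr 6 _∧_
infixr 5 _∨_

data Formula : Set where
  atom : Atom → Formula
  _∧_  : Formula → Formula → Formula
  _∨_  : Formula → Formula → Formula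
  Ex   : Formula → Formula
  All  : Formula → Formula

𝕥 𝕗 : Formula
𝕥 = atom tt
𝕗 = atom ff

ren : (ℕ → ℕ) → Formula → Formula
ren ρ (atom a) = atom (renA ρ a)
ren ρ (A ∧ B)  = ren ρ A ∧ ren ρ B
ren ρ (A ∨ B)  = ren ρ A ∨ ren ρ B
ren ρ (Ex A)   = Ex (ren (ext ρ) A)
ren ρ (All A)  = All (ren (ext ρ) A)

sub : (ℕ → Term) → Formula → Formula
sub σ (atom a) = atom (subA σ a)
sub σ (A ∧ B)  = sub σ A ∧ sub σ B
sub σ (A ∨ B)  = sub σ A ∨ sub σ B
sub σ (Ex A)   = Ex (sub (exts σ) A)
sub σ (All A)  = All (sub (exts σ) A)

-- weakening: the formula does not mention the newly bound variable 0
shift : Formula → Formula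
shift = ren suc

-- A[x/t] where x is the variable bound by the outermost binder (index 0)
single : Term → ℕ → Term
single t zero    = t
single t (suc n) = var n

_[_] : Formula → Term → Formula
A [ t ] = sub (single t) A

swap01 : ℕ → ℕ
swap01 zero          = suc zero
swap01 (suc zero)    = zero
swap01 (suc (suc n)) = suc (suc n)

-- Sequents: finite multisets, represented by lists together with an
-- exchange rule (permutation).

Sequent : Set
Sequent = List Formula

data ⊢_ : Sequent → Set where
  ax   : ∀ a → ⊢ (atom a ∷ atom (dual a) ∷ [])
  ∨-r  : ∀ {Γ A B} → ⊢ (A ∷ B ∷ Γ) → ⊢ ((A ∨ B) ∷ Γ)
  ∧-r  : ∀ {Γ Δ A B} → ⊢ (A ∷ Γ) → ⊢ (B ∷ Δ) → ⊢ ((A ∧ B) ∷ Γ ++ Δ)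
  t-r  : ⊢ (𝕥 ∷ [])
  f-r  : ∀ {Γ} → ⊢ Γ → ⊢ (𝕗 ∷ Γ)
  mix  : ∀ {Γ Δ} → ⊢ Γ → ⊢ Δ → ⊢ (Γ ++ Δ)
  ∃-r  : ∀ {Γ A} (t : Term) → ⊢ ((A [ t ]) ∷ Γ) → ⊢ (Ex A ∷ Γ)
  -- eigenvariable condition: x (index 0) is not free in (the weakened) Γ
  ∀-r  : ∀ {Γ A} → ⊢ (A ∷ map shift Γ) → ⊢ (All A ∷ Γ)
  ctr  : ∀ {Γ A} → ⊢ (A ∷ A ∷ Γ) → ⊢ (A ∷ Γ)
  wk   : ∀ {Γ A} → ⊢ Γ → ⊢ (A ∷ Γ)
  exch : ∀ {Γ Δ} → Γ ↭ Δ → ⊢ Γ → ⊢ Δ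

infix 4 _≅_

data _≅_ : Formula → Formula → Set where
  refl≅  : ∀ {A} → A ≅ A
  sym≅   : ∀ {A B} → A ≅ B → B ≅ A
  trans≅ : ∀ {A B C} → A ≅ B → B ≅ C → A ≅ C
  cong∧  : ∀ {A A' B B'} → A ≅ A' → B ≅ B' → (A ∧ B) ≅ (A' ∧ B')
  cong∨  : ∀ {A A' B B'} → A ≅ A' → B ≅ B' → (A ∨ B) ≅ (A' ∨ B')
  congEx : ∀ {A A'} → A ≅ A' → Ex A ≅ Ex A'
  congAll : ∀ {A A'} → A ≅ A' → All A ≅ All A'
  ∧-comm  : ∀ {A B} → (A ∧ B) ≅ (B ∧ A)
  ∨-comm  : ∀ {A B} → (A ∨ B) ≅ (B ∨ A)
  ∧-assoc : ∀ {A B C} → ((A ∧ B) ∧ C) ≅ (A ∧ (B ∧ C))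
  ∨-assoc : ∀ {A B C} → ((A ∨ B) ∨ C) ≅ (A ∨ (B ∨ C))
  All-swap : ∀ {A} → All (All A) ≅ All (All (ren swap01 A))
  Ex-swap  : ∀ {A} → Ex (Ex A) ≅ Ex (Ex (ren swap01 A))
  -- ∀x.(A ∨ B) ≡ (∀x.A) ∨ B, x not free in B
  All-∨ : ∀ {A B} → All (A ∨ shift B) ≅ (All A ∨ B)
  -- ∃x.(A ∧ B) ≡ (∃x.A) ∧ B, x not free in B
  Ex-∧  : ∀ {A B} → Ex (A ∧ shift B) ≅ (Ex A ∧ B)

data Ctx : Set where
  hole : Ctx
  _∧ₗ_ : Ctx → Formula → Ctx
  _∧ᵣ_ : Formula → Ctx → Ctx
  _∨ₗ_ : Ctx → Formula → Ctx
  _∨ᵣ_ : Formula → Ctx → Ctx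
  Exᶜ  : Ctx → Ctx
  Allᶜ : Ctx → Ctx

plug : Ctx → Formula → Formula
plug hole     X = X
plug (S ∧ₗ B) X = plug S X ∧ B
plug (A ∧ᵣ S) X = A ∧ plug S X
plug (S ∨ₗ B) X = plug S X ∨ B
plug (A ∨ᵣ S) X = A ∨ plug S X
plug (Exᶜ S)  X = Ex (plug S X)
plug (Allᶜ S) X = All (plug S X)

-- KS1 rules, written premise ⟶ conclusion (at the hole)

infix 4 _⟶_

data _⟶_ : Formula → Formula → Set where
  ∀-rule : 𝕥 ⟶ All 𝕥
  ai     : ∀ a → 𝕥 ⟶ (atom a ∨ atom (dual a))
  t-rule : ∀ {A} → A ⟶ (A ∧ 𝕥)
  s      : ∀ {A B C} → (A ∧ (B ∨ C)) ⟶ ((A ∧ B) ∨ C)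
  mixᵏ   : ∀ {A B} → (A ∧ B) ⟶ (A ∨ B)
  ∃-rule : ∀ {A} (t : Term) → (A [ t ]) ⟶ Ex A
  ≡-rule : ∀ {A B} → A ≅ B → B ⟶ A
  w      : ∀ {A B} → A ⟶ (A ∨ B)
  m      : ∀ {A B C D} → ((A ∧ C) ∨ (B ∧ D)) ⟶ ((A ∨ B) ∧ (C ∨ D))
  ac     : ∀ a → (atom a ∨ atom a) ⟶ atom a
  m∀     : ∀ {A B} → (All A ∨ All B) ⟶ All (A ∨ B)
  m∃     : ∀ {A B} → (Ex A ∨ Ex B) ⟶ Ex (A ∨ B)
  -- S{A} ⟶ S{∀x.A}, x not free in A
  w∀     : ∀ {A} → A ⟶ All (shift A)
  -- S{∀x.∀x.A} ⟶ S{∀x.A}: the outer binder is vacuous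
  c∀     : ∀ {A} → All (All (ren (ext suc) A)) ⟶ All A

data KS1-step : Formula → Formula → Set where
  step : ∀ (S : Ctx) {P C} → P ⟶ C → KS1-step (plug S P) (plug S C)

KS1-provable : Formula → Set
KS1-provable A = Star KS1-step 𝕥 A

-- ⋁Γ for a non-empty sequent A₁, …, Aₙ : A₁ ∨ (A₂ ∨ (… ∨ Aₙ))

⋁ : Formula → List Formula → Formula
⋁ A []      = A
⋁ A (B ∷ Γ) = A ∨ ⋁ B Γ

{-# OPTIONS --safe #-}
-- LK1 ⇒ KS1: each LK1 rule becomes a short KS1 derivation between the disjunctions of its
-- premises and its conclusion; contraction of a compound formula is reduced to the atomic
-- contraction ac by the medial rules m, m∀ and m∃.
-- KS1 ⇒ LK1: a KS1 step P ⟶ C is read as "⊢ P, Γ implies ⊢ C, Γ". This passes through ∨, ∧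
-- and ∀ contexts because those LK1 rules are invertible. ∃ is not invertible, so a rewrite
-- below an ∃ is instead pushed up the LK1 proof to the ∃-rules introducing the copies of it.
module Submission where

open import Data.Nat using (zero; suc)
open import Data.Empty using (⊥; ⊥-elim)
open import Data.Product using (Σ-syntax; _×_; _,_; proj₁; proj₂)
open import Data.List using (List; []; _∷_; _++_; map)
open import Data.List.Properties using (map-++; ++-assoc; ++-identityʳ; map-cong)
import Data.List.Relation.Binary.Permutation.Propositional as Perm
open Perm using (_↭_; prep; swap; ↭-refl; ↭-sym; ↭-trans; ↭-reflexive)
open import Data.List.Relation.Binary.Permutation.Propositional.Properties
  using (map⁺; ++⁺ˡ; ++⁺ʳ; ++-comm; shifts; ¬x∷xs↭[])
  renaming (shift to ↭-shift)
open import Relation.Binary.PropositionalEquality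
  using (_≡_; refl; sym; trans; cong; cong₂; subst; subst₂; _≗_; module ≡-Reasoning)
open import Relation.Binary.Construct.Closure.ReflexiveTransitive using (Star; ε; _◅_; _◅◅_)
open import Function using (_∘_; id)
open import Function.Bundles using (_⇔_; mk⇔)

open import Defs

mutual
  subT-cong : ∀ {σ τ} → σ ≗ τ → subT σ ≗ subT τ
  subT-cong e (var x)    = e x
  subT-cong e (fun f ts) = cong (fun f) (subTs-cong e ts)

  subTs-cong : ∀ {σ τ} → σ ≗ τ → subTs σ ≗ subTs τ
  subTs-cong e []       = refl
  subTs-cong e (t ∷ ts) = cong₂ _∷_ (subT-cong e t) (subTs-cong e ts)

mutual
  renT-as-subT : ∀ ρ → renT ρ ≗ subT (var ∘ ρ)
  renT-as-subT ρ (var x)    = refl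
  renT-as-subT ρ (fun f ts) = cong (fun f) (renTs-as-subTs ρ ts)

  renTs-as-subTs : ∀ ρ → renTs ρ ≗ subTs (var ∘ ρ)
  renTs-as-subTs ρ []       = refl
  renTs-as-subTs ρ (t ∷ ts) = cong₂ _∷_ (renT-as-subT ρ t) (renTs-as-subTs ρ ts)

mutual
  subT-subT : ∀ σ τ t → subT σ (subT τ t) ≡ subT (subT σ ∘ τ) t
  subT-subT σ τ (var x)    = refl
  subT-subT σ τ (fun f ts) = cong (fun f) (subTs-subTs σ τ ts)

  subTs-subTs : ∀ σ τ ts → subTs σ (subTs τ ts) ≡ subTs (subT σ ∘ τ) ts
  subTs-subTs σ τ []       = refl
  subTs-subTs σ τ (t ∷ ts) = cong₂ _∷_ (subT-subT σ τ t) (subTs-subTs σ τ ts)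

mutual
  subT-var : subT var ≗ id
  subT-var (var x)    = refl
  subT-var (fun f ts) = cong (fun f) (subTs-var ts)

  subTs-var : subTs var ≗ id
  subTs-var []       = refl
  subTs-var (t ∷ ts) = cong₂ _∷_ (subT-var t) (subTs-var ts)

subT-renT : ∀ σ ρ t → subT σ (renT ρ t) ≡ subT (σ ∘ ρ) t
subT-renT σ ρ t = trans (cong (subT σ) (renT-as-subT ρ t)) (subT-subT σ (var ∘ ρ) t)

renT-renT : ∀ ρ τ t → renT ρ (renT τ t) ≡ renT (ρ ∘ τ) t
renT-renT ρ τ t =
  trans (renT-as-subT ρ _) (trans (subT-renT (var ∘ ρ) τ t) (sym (renT-as-subT (ρ ∘ τ) t)))

subT-single-renT-suc : ∀ u t → subT (single u) (renT suc t) ≡ t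
subT-single-renT-suc u t = trans (subT-renT (single u) suc t) (subT-var t)

subA-cong : ∀ {σ τ} → σ ≗ τ → subA σ ≗ subA τ
subA-cong e tt            = refl
subA-cong e ff            = refl
subA-cong e (pred b p ts) = cong (pred b p) (subTs-cong e ts)

renA-as-subA : ∀ ρ → renA ρ ≗ subA (var ∘ ρ)
renA-as-subA ρ tt            = refl
renA-as-subA ρ ff            = refl
renA-as-subA ρ (pred b p ts) = cong (pred b p) (renTs-as-subTs ρ ts)

subA-subA : ∀ σ τ a → subA σ (subA τ a) ≡ subA (subT σ ∘ τ) a
subA-subA σ τ tt            = refl
subA-subA σ τ ff            = refl
subA-subA σ τ (pred b p ts) = cong (pred b p) (subTs-subTs σ τ ts)

subA-var : subA var ≗ id
subA-var tt            = refl
subA-var ff            = refl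
subA-var (pred b p ts) = cong (pred b p) (subTs-var ts)

subA-dual : ∀ σ a → subA σ (dual a) ≡ dual (subA σ a)
subA-dual σ tt            = refl
subA-dual σ ff            = refl
subA-dual σ (pred b p ts) = refl

exts-cong : ∀ {σ τ} → σ ≗ τ → exts σ ≗ exts τ
exts-cong e zero    = refl
exts-cong e (suc n) = cong (renT suc) (e n)

sub-cong : ∀ {σ τ} → σ ≗ τ → sub σ ≗ sub τ
sub-cong e (atom a) = cong atom (subA-cong e a)
sub-cong e (A ∧ B)  = cong₂ _∧_ (sub-cong e A) (sub-cong e B)
sub-cong e (A ∨ B)  = cong₂ _∨_ (sub-cong e A) (sub-cong e B)
sub-cong e (Ex A)   = cong Ex (sub-cong (exts-cong e) A)
sub-cong e (All A)  = cong All (sub-cong (exts-cong e) A)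

exts-var∘ : ∀ ρ → exts (var ∘ ρ) ≗ var ∘ ext ρ
exts-var∘ ρ zero    = refl
exts-var∘ ρ (suc n) = refl

ren-as-sub : ∀ ρ → ren ρ ≗ sub (var ∘ ρ)
ren-as-sub ρ (atom a) = cong atom (renA-as-subA ρ a)
ren-as-sub ρ (A ∧ B)  = cong₂ _∧_ (ren-as-sub ρ A) (ren-as-sub ρ B)
ren-as-sub ρ (A ∨ B)  = cong₂ _∨_ (ren-as-sub ρ A) (ren-as-sub ρ B)
ren-as-sub ρ (Ex A)   = cong Ex (trans (ren-as-sub (ext ρ) A) (sym (sub-cong (exts-var∘ ρ) A)))
ren-as-sub ρ (All A)  = cong All (trans (ren-as-sub (ext ρ) A) (sym (sub-cong (exts-var∘ ρ) A)))

exts-subT : ∀ σ τ → subT (exts σ) ∘ exts τ ≗ exts (subT σ ∘ τ)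
exts-subT σ τ zero    = refl
exts-subT σ τ (suc n) = begin
  subT (exts σ) (renT suc (τ n))   ≡⟨ subT-renT (exts σ) suc (τ n) ⟩
  subT (renT suc ∘ σ) (τ n)        ≡⟨ subT-cong (λ x → renT-as-subT suc (σ x)) (τ n) ⟩
  subT (subT (var ∘ suc) ∘ σ) (τ n) ≡⟨ sym (subT-subT (var ∘ suc) σ (τ n)) ⟩
  subT (var ∘ suc) (subT σ (τ n))  ≡⟨ sym (renT-as-subT suc (subT σ (τ n))) ⟩
  renT suc (subT σ (τ n))          ∎
  where open ≡-Reasoning

sub-sub : ∀ σ τ A → sub σ (sub τ A) ≡ sub (subT σ ∘ τ) A
sub-sub σ τ (atom a) = cong atom (subA-subA σ τ a)
sub-sub σ τ (A ∧ B)  = cong₂ _∧_ (sub-sub σ τ A) (sub-sub σ τ B)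
sub-sub σ τ (A ∨ B)  = cong₂ _∨_ (sub-sub σ τ A) (sub-sub σ τ B)
sub-sub σ τ (Ex A)   = cong Ex (trans (sub-sub (exts σ) (exts τ) A) (sub-cong (exts-subT σ τ) A))
sub-sub σ τ (All A)  = cong All (trans (sub-sub (exts σ) (exts τ) A) (sub-cong (exts-subT σ τ) A))

exts-var : exts var ≗ var
exts-var zero    = refl
exts-var (suc n) = refl

sub-var : sub var ≗ id
sub-var (atom a) = cong atom (subA-var a)
sub-var (A ∧ B)  = cong₂ _∧_ (sub-var A) (sub-var B)
sub-var (A ∨ B)  = cong₂ _∨_ (sub-var A) (sub-var B)
sub-var (Ex A)   = cong Ex (trans (sub-cong exts-var A) (sub-var A))
sub-var (All A)  = cong All (trans (sub-cong exts-var A) (sub-var A))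

sub-ren : ∀ σ ρ A → sub σ (ren ρ A) ≡ sub (σ ∘ ρ) A
sub-ren σ ρ A = trans (cong (sub σ) (ren-as-sub ρ A)) (sub-sub σ (var ∘ ρ) A)

ren-sub : ∀ ρ σ A → ren ρ (sub σ A) ≡ sub (renT ρ ∘ σ) A
ren-sub ρ σ A = trans (ren-as-sub ρ _)
  (trans (sub-sub (var ∘ ρ) σ A) (sub-cong (λ x → sym (renT-as-subT ρ (σ x))) A))

ren-ren : ∀ ρ τ A → ren ρ (ren τ A) ≡ ren (ρ ∘ τ) A
ren-ren ρ τ A = trans (ren-as-sub ρ _) (trans (sub-ren (var ∘ ρ) τ A) (sym (ren-as-sub (ρ ∘ τ) A)))

ren-cong : ∀ {ρ τ} → ρ ≗ τ → ren ρ ≗ ren τ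
ren-cong {ρ} {τ} e A =
  trans (ren-as-sub ρ A) (trans (sub-cong (cong var ∘ e) A) (sym (ren-as-sub τ A)))

sub-ren-cancel : ∀ {σ ρ} → σ ∘ ρ ≗ var → ∀ A → sub σ (ren ρ A) ≡ A
sub-ren-cancel {σ} {ρ} e A = trans (sub-ren σ ρ A) (trans (sub-cong e A) (sub-var A))

sub-ren-comm : ∀ {σ σ′ ρ ρ′} → σ′ ∘ ρ ≗ renT ρ′ ∘ σ →
               ∀ A → sub σ′ (ren ρ A) ≡ ren ρ′ (sub σ A)
sub-ren-comm {σ} {σ′} {ρ} {ρ′} e A =
  trans (sub-ren σ′ ρ A) (trans (sub-cong e A) (sym (ren-sub ρ′ σ A)))

sub-sub-≗ : ∀ {σ τ σ′ τ′} → subT σ ∘ τ ≗ subT σ′ ∘ τ′ →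
            ∀ A → sub σ (sub τ A) ≡ sub σ′ (sub τ′ A)
sub-sub-≗ {σ} {τ} {σ′} {τ′} e A =
  trans (sub-sub σ τ A) (trans (sub-cong e A) (sym (sub-sub σ′ τ′ A)))

[]-shift : ∀ t B → shift B [ t ] ≡ B
[]-shift t = sub-ren-cancel λ _ → refl

[var0]-ren-ext-suc : ∀ B → ren (ext suc) B [ var zero ] ≡ B
[var0]-ren-ext-suc = sub-ren-cancel λ { zero → refl ; (suc n) → refl }

sub-shift : ∀ σ A → sub (exts σ) (shift A) ≡ shift (sub σ A)
sub-shift σ = sub-ren-comm λ _ → refl

ren-shift : ∀ ρ A → ren (ext ρ) (shift A) ≡ shift (ren ρ A)
ren-shift ρ A = trans (ren-ren (ext ρ) suc A) (sym (ren-ren suc ρ A))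

sub-[] : ∀ σ t A → sub σ (A [ t ]) ≡ sub (exts σ) A [ subT σ t ]
sub-[] σ t = sub-sub-≗ λ { zero → refl ; (suc n) → sym (subT-single-renT-suc (subT σ t) (σ n)) }

ren-[] : ∀ ρ t A → ren ρ (A [ t ]) ≡ ren (ext ρ) A [ renT ρ t ]
ren-[] ρ t A = begin
  ren ρ (A [ t ])
    ≡⟨ ren-as-sub ρ _ ⟩
  sub (var ∘ ρ) (A [ t ])
    ≡⟨ sub-[] (var ∘ ρ) t A ⟩
  sub (exts (var ∘ ρ)) A [ subT (var ∘ ρ) t ]
    ≡⟨ cong₂ _[_] (sub-cong (exts-var∘ ρ) A) (sym (renT-as-subT ρ t)) ⟩
  sub (var ∘ ext ρ) A [ renT ρ t ]
    ≡⟨ cong (_[ renT ρ t ]) (sym (ren-as-sub (ext ρ) A)) ⟩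
  ren (ext ρ) A [ renT ρ t ]
    ∎
  where open ≡-Reasoning

sub-ren-ext-suc : ∀ σ A → sub (exts (exts σ)) (ren (ext suc) A) ≡ ren (ext suc) (sub (exts σ) A)
sub-ren-ext-suc σ = sub-ren-comm λ
  { zero    → refl
  ; (suc n) → trans (renT-renT suc suc (σ n)) (sym (renT-renT (ext suc) suc (σ n))) }

sub-ren-swap01 : ∀ σ A → sub (exts (exts σ)) (ren swap01 A) ≡ ren swap01 (sub (exts (exts σ)) A)
sub-ren-swap01 σ = sub-ren-comm λ
  { zero          → refl
  ; (suc zero)    → refl
  ; (suc (suc n)) → trans (renT-renT suc suc (σ n))
                      (sym (trans (renT-renT swap01 suc _) (renT-renT (swap01 ∘ suc) suc (σ n)))) }

ren-swap01-involutive : ∀ A → ren swap01 (ren swap01 A) ≡ A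
ren-swap01-involutive A = trans (ren-as-sub swap01 _) (sub-ren-cancel
  (λ { zero → refl ; (suc zero) → refl ; (suc (suc n)) → refl }) A)

subst-head : ∀ {X Y Γ} → X ≡ Y → ⊢ (X ∷ Γ) → ⊢ (Y ∷ Γ)
subst-head refl d = d

subst-tail : ∀ {X Γ Δ} → Γ ≡ Δ → ⊢ (X ∷ Γ) → ⊢ (X ∷ Δ)
subst-tail refl d = d

exch-swap : ∀ {X Y Γ} → ⊢ (X ∷ Y ∷ Γ) → ⊢ (Y ∷ X ∷ Γ)
exch-swap = exch (swap _ _ ↭-refl)

wk-++ˡ : ∀ Δ {Γ} → ⊢ Γ → ⊢ (Δ ++ Γ)
wk-++ˡ []      d = d
wk-++ˡ (X ∷ Δ) d = wk (wk-++ˡ Δ d)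

wk-++ʳ : ∀ Δ {Γ} → ⊢ Γ → ⊢ (Γ ++ Δ)
wk-++ʳ Δ {Γ} d = exch (++-comm Δ Γ) (wk-++ˡ Δ d)

ctr-++ : ∀ Δ {Γ} → ⊢ (Δ ++ Δ ++ Γ) → ⊢ (Δ ++ Γ)
ctr-++ []      d = d
ctr-++ (X ∷ Δ) {Γ} d =
  exch (↭-shift X Δ Γ)
    (ctr-++ Δ (exch (↭-sym X-to-front) (ctr (exch (prep X (↭-shift X Δ (Δ ++ Γ))) d))))
  where
  X-to-front : Δ ++ Δ ++ X ∷ Γ ↭ X ∷ Δ ++ Δ ++ Γ
  X-to-front = ↭-trans (++⁺ˡ Δ (↭-shift X Δ Γ)) (↭-shift X Δ (Δ ++ Γ))

ctr-++ʳ : ∀ Γ Δ → ⊢ (Γ ++ Δ ++ Δ) → ⊢ (Γ ++ Δ)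
ctr-++ʳ Γ Δ d = exch (++-comm Δ Γ)
  (ctr-++ Δ (exch (↭-trans (++-comm Γ (Δ ++ Δ)) (↭-reflexive (++-assoc Δ Δ Γ))) d))

∧-r-shared : ∀ {X Y Γ} → ⊢ (X ∷ Γ) → ⊢ (Y ∷ Γ) → ⊢ ((X ∧ Y) ∷ Γ)
∧-r-shared {Γ = Γ} d e = ctr-++ʳ (_ ∷ []) Γ (∧-r d e)

ctr-pair : ∀ {X Y} Γ → ⊢ (X ∷ Γ ++ Y ∷ Γ) → ⊢ (X ∷ Y ∷ Γ)
ctr-pair {X} {Y} Γ d = ctr-++ʳ (X ∷ Y ∷ []) Γ (exch (prep X (↭-shift Y Γ Γ)) d)

merge-contexts : ∀ Γ Δ E → ⊢ ((Γ ++ E) ++ (Δ ++ E)) → ⊢ ((Γ ++ Δ) ++ E)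
merge-contexts Γ Δ E d = ctr-++ʳ (Γ ++ Δ) E (exch interleave d)
  where
  interleave : (Γ ++ E) ++ (Δ ++ E) ↭ (Γ ++ Δ) ++ E ++ E
  interleave = ↭-trans (↭-reflexive (++-assoc Γ E (Δ ++ E)))
    (↭-trans (++⁺ˡ Γ (++-comm E (Δ ++ E)))
    (↭-reflexive (trans (cong (Γ ++_) (++-assoc Δ E E)) (sym (++-assoc Γ Δ (E ++ E))))))

map-sub-shift : ∀ σ Γ → map (sub (exts σ)) (map shift Γ) ≡ map shift (map (sub σ) Γ)
map-sub-shift σ []      = refl
map-sub-shift σ (X ∷ Γ) = cong₂ _∷_ (sub-shift σ X) (map-sub-shift σ Γ)

ax-subA : ∀ σ a → ⊢ (atom (subA σ a) ∷ atom (subA σ (dual a)) ∷ [])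
ax-subA σ a = subst (λ b → ⊢ (atom (subA σ a) ∷ atom b ∷ [])) (sym (subA-dual σ a)) (ax (subA σ a))

sub-admissible : ∀ σ {Γ} → ⊢ Γ → ⊢ (map (sub σ) Γ)
sub-admissible σ (ax a) = ax-subA σ a
sub-admissible σ (∨-r d) = ∨-r (sub-admissible σ d)
sub-admissible σ (∧-r {Γ} {Δ} d e) =
  subst-tail (sym (map-++ (sub σ) Γ Δ)) (∧-r (sub-admissible σ d) (sub-admissible σ e))
sub-admissible σ t-r = t-r
sub-admissible σ (f-r d) = f-r (sub-admissible σ d)
sub-admissible σ (mix {Γ} {Δ} d e) =
  subst ⊢_ (sym (map-++ (sub σ) Γ Δ)) (mix (sub-admissible σ d) (sub-admissible σ e))
sub-admissible σ (∃-r {A = A} t d) = ∃-r (subT σ t) (subst-head (sub-[] σ t A) (sub-admissible σ d))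
sub-admissible σ (∀-r {Γ} d) =
  ∀-r (subst-tail (map-sub-shift σ Γ) (sub-admissible (exts σ) d))
sub-admissible σ (ctr d) = ctr (sub-admissible σ d)
sub-admissible σ (wk d) = wk (sub-admissible σ d)
sub-admissible σ (exch p d) = exch (map⁺ (sub σ) p) (sub-admissible σ d)

ren-admissible : ∀ ρ {Γ} → ⊢ Γ → ⊢ (map (ren ρ) Γ)
ren-admissible ρ {Γ} d = subst ⊢_ (sym (map-cong (ren-as-sub ρ) Γ)) (sub-admissible (var ∘ ρ) d)

infixr 5 _∷ᵇ_

data Blockwise (Q : Formula → List Formula → Set) : List Formula → List Formula → Set where
  []ᵇ  : Blockwise Q [] []
  _∷ᵇ_ : ∀ {X L Γ Γ′} → Q X L → Blockwise Q Γ Γ′ → Blockwise Q (X ∷ Γ) (L ++ Γ′)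

module _ {Q : Formula → List Formula → Set} where

  Blockwise-refl : (∀ {X} → Q X (X ∷ [])) → ∀ Γ → Blockwise Q Γ Γ
  Blockwise-refl q []      = []ᵇ
  Blockwise-refl q (X ∷ Γ) = q ∷ᵇ Blockwise-refl q Γ

  Blockwise-++⁻ : ∀ Γ {Δ Θ} → Blockwise Q (Γ ++ Δ) Θ →
                  Σ[ Γ′ ∈ List Formula ] Σ[ Δ′ ∈ List Formula ]
                    Θ ≡ Γ′ ++ Δ′ × Blockwise Q Γ Γ′ × Blockwise Q Δ Δ′
  Blockwise-++⁻ []      qs = [] , _ , refl , []ᵇ , qs
  Blockwise-++⁻ (X ∷ Γ) (_∷ᵇ_ {L = L} q qs) with Blockwise-++⁻ Γ qs
  ... | Γ′ , Δ′ , refl , qs₁ , qs₂ = L ++ Γ′ , Δ′ , sym (++-assoc L Γ′ Δ′) , q ∷ᵇ qs₁ , qs₂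

  Blockwise-↭ : ∀ {Γ Δ Δ′} → Γ ↭ Δ → Blockwise Q Δ Δ′ →
                Σ[ Γ′ ∈ List Formula ] Blockwise Q Γ Γ′ × Γ′ ↭ Δ′
  Blockwise-↭ Perm.refl qs = _ , qs , ↭-refl
  Blockwise-↭ (prep X p) (_∷ᵇ_ {L = L} q qs) with Blockwise-↭ p qs
  ... | Γ′ , qs′ , p′ = L ++ Γ′ , q ∷ᵇ qs′ , ++⁺ˡ L p′
  Blockwise-↭ (swap X Y p) (_∷ᵇ_ {L = L₁} q₁ (_∷ᵇ_ {L = L₂} q₂ qs)) with Blockwise-↭ p qs
  ... | Γ′ , qs′ , p′ =
    L₂ ++ L₁ ++ Γ′ , q₂ ∷ᵇ q₁ ∷ᵇ qs′ , ↭-trans (++⁺ˡ L₂ (++⁺ˡ L₁ p′)) (shifts L₂ L₁)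
  Blockwise-↭ (Perm.trans p₁ p₂) qs with Blockwise-↭ p₂ qs
  ... | Γ₂ , qs₂ , p₂′ with Blockwise-↭ p₁ qs₂
  ... | Γ₁ , qs₁ , p₁′ = Γ₁ , qs₁ , ↭-trans p₁′ p₂′

Blockwise-map : ∀ {Q Q′ : Formula → List Formula → Set} (f : Formula → Formula) →
                (∀ {X L} → Q X L → Q′ (f X) (map f L)) →
                ∀ {Γ Γ′} → Blockwise Q Γ Γ′ → Blockwise Q′ (map f Γ) (map f Γ′)
Blockwise-map f h []ᵇ = []ᵇ
Blockwise-map f h (_∷ᵇ_ {L = L} {Γ′ = Γ′} q qs) =
  subst (Blockwise _ _) (sym (map-++ f L Γ′)) (h q ∷ᵇ Blockwise-map f h qs)

-- Invertibility of ∨, ∧ and ∀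

data Inversion : Formula → List Formula → Set where
  keep   : ∀ {X} → Inversion X (X ∷ [])
  ∨-inv  : ∀ {A B} → Inversion (A ∨ B) (A ∷ B ∷ [])
  ∧-invˡ : ∀ {A B} → Inversion (A ∧ B) (A ∷ [])
  ∧-invʳ : ∀ {A B} → Inversion (A ∧ B) (B ∷ [])
  ∀-inv  : ∀ {A} t → Inversion (All A) (A [ t ] ∷ [])

Inversion-shift : ∀ {X L} → Inversion X L → Inversion (shift X) (map shift L)
Inversion-shift keep   = keep
Inversion-shift ∨-inv  = ∨-inv
Inversion-shift ∧-invˡ = ∧-invˡ
Inversion-shift ∧-invʳ = ∧-invʳ
Inversion-shift (∀-inv {A} t) =
  subst (λ B → Inversion (shift (All A)) (B ∷ [])) (sym (ren-[] suc t A)) (∀-inv (renT suc t))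

map-[]-shift : ∀ t Γ → map (_[ t ]) (map shift Γ) ≡ Γ
map-[]-shift t []      = refl
map-[]-shift t (X ∷ Γ) = cong₂ _∷_ ([]-shift t X) (map-[]-shift t Γ)

invert : ∀ {Γ Γ′} → ⊢ Γ → Blockwise Inversion Γ Γ′ → ⊢ Γ′
invert (ax a) (keep ∷ᵇ keep ∷ᵇ []ᵇ) = ax a
invert (∨-r d) (keep ∷ᵇ qs)  = ∨-r (invert d (keep ∷ᵇ keep ∷ᵇ qs))
invert (∨-r d) (∨-inv ∷ᵇ qs) = invert d (keep ∷ᵇ keep ∷ᵇ qs)
invert (∧-r {Γ} d e) (q ∷ᵇ qs) with Blockwise-++⁻ Γ qs | q
... | Γ′ , Δ′ , refl , qs₁ , qs₂ | keep   = ∧-r (invert d (keep ∷ᵇ qs₁)) (invert e (keep ∷ᵇ qs₂))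
... | Γ′ , Δ′ , refl , qs₁ , qs₂ | ∧-invˡ = wk-++ʳ Δ′ (invert d (keep ∷ᵇ qs₁))
... | Γ′ , Δ′ , refl , qs₁ , qs₂ | ∧-invʳ = exch (↭-shift _ Γ′ Δ′) (wk-++ˡ Γ′ (invert e (keep ∷ᵇ qs₂)))
invert t-r (keep ∷ᵇ []ᵇ) = t-r
invert (f-r d) (keep ∷ᵇ qs) = f-r (invert d qs)
invert (mix {Γ} d e) qs with Blockwise-++⁻ Γ qs
... | Γ′ , Δ′ , refl , qs₁ , qs₂ = mix (invert d qs₁) (invert e qs₂)
invert (∃-r t d) (keep ∷ᵇ qs) = ∃-r t (invert d (keep ∷ᵇ qs))
invert (∀-r d) (keep ∷ᵇ qs) = ∀-r (invert d (keep ∷ᵇ Blockwise-map shift Inversion-shift qs))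
invert (∀-r d) (_∷ᵇ_ {Γ′ = Γ′} (∀-inv t) qs) =
  subst-tail (map-[]-shift t Γ′)
    (sub-admissible (single t) (invert d (keep ∷ᵇ Blockwise-map shift Inversion-shift qs)))
invert (ctr d) (_∷ᵇ_ {L = L} q qs) = ctr-++ L (invert d (q ∷ᵇ q ∷ᵇ qs))
invert (wk d) (_∷ᵇ_ {L = L} q qs) = wk-++ˡ L (invert d qs)
invert (exch p d) qs with Blockwise-↭ p qs
... | Γ′ , qs′ , p′ = exch p′ (invert d qs′)

∨-inversion : ∀ {A B Γ} → ⊢ ((A ∨ B) ∷ Γ) → ⊢ (A ∷ B ∷ Γ)
∨-inversion {Γ = Γ} d = invert d (∨-inv ∷ᵇ Blockwise-refl keep Γ)

∧-inversionˡ : ∀ {A B Γ} → ⊢ ((A ∧ B) ∷ Γ) → ⊢ (A ∷ Γ)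
∧-inversionˡ {Γ = Γ} d = invert d (∧-invˡ ∷ᵇ Blockwise-refl keep Γ)

∧-inversionʳ : ∀ {A B Γ} → ⊢ ((A ∧ B) ∷ Γ) → ⊢ (B ∷ Γ)
∧-inversionʳ {Γ = Γ} d = invert d (∧-invʳ ∷ᵇ Blockwise-refl keep Γ)

∀-instance : ∀ {A Γ} t → ⊢ (All A ∷ Γ) → ⊢ (A [ t ] ∷ Γ)
∀-instance {Γ = Γ} t d = invert d (∀-inv t ∷ᵇ Blockwise-refl keep Γ)

shift-All-inversion : ∀ {A Γ} → ⊢ (shift (All A) ∷ Γ) → ⊢ (A ∷ Γ)
shift-All-inversion {A} d = subst-head ([var0]-ren-ext-suc A) (∀-instance (var zero) d)

∀-inversion : ∀ {A Γ} → ⊢ (All A ∷ Γ) → ⊢ (A ∷ map shift Γ)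
∀-inversion d = shift-All-inversion (ren-admissible suc d)

-- Replacing ∃-formulas throughout a proof

-- R E A Y: every ∃A in a conclusion may be replaced by Y at the cost of adding the side
-- formulas E once, since each instance A[t] yields Y in the presence of E.
module ExReplace
  (R : List Formula → Formula → Formula → Set)
  (R-shift : ∀ {E A Y} → R E A Y → R (map shift E) (ren (ext suc) A) (shift Y))
  (R-instance : ∀ {E A Y} t Δ → R E A Y → ⊢ (A [ t ] ∷ Δ ++ E) → ⊢ (Y ∷ Δ ++ E))
  where

  data Replace (E : List Formula) : Formula → List Formula → Set where
    keep    : ∀ {X} → Replace E X (X ∷ [])
    replace : ∀ {A Y} → R E A Y → Replace E (Ex A) (Y ∷ [])

  Replace-shift : ∀ {E X L} → Replace E X L → Replace (map shift E) (shift X) (map shift L)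
  Replace-shift keep        = keep
  Replace-shift (replace r) = replace (R-shift r)

  replace-∃ : ∀ {E Γ Γ′} → ⊢ Γ → Blockwise (Replace E) Γ Γ′ → ⊢ (Γ′ ++ E)
  replace-∃ {E} (ax a) (keep ∷ᵇ keep ∷ᵇ []ᵇ) = wk-++ʳ E (ax a)
  replace-∃ (∨-r d) (keep ∷ᵇ qs) = ∨-r (replace-∃ d (keep ∷ᵇ keep ∷ᵇ qs))
  replace-∃ {E} (∧-r {Γ} d e) (keep ∷ᵇ qs) with Blockwise-++⁻ Γ qs
  ... | Γ′ , Δ′ , refl , qs₁ , qs₂ =
    merge-contexts (_ ∷ Γ′) Δ′ E (∧-r (replace-∃ d (keep ∷ᵇ qs₁)) (replace-∃ e (keep ∷ᵇ qs₂)))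
  replace-∃ {E} t-r (keep ∷ᵇ []ᵇ) = wk-++ʳ E t-r
  replace-∃ (f-r d) (keep ∷ᵇ qs) = f-r (replace-∃ d qs)
  replace-∃ {E} (mix {Γ} d e) qs with Blockwise-++⁻ Γ qs
  ... | Γ′ , Δ′ , refl , qs₁ , qs₂ = merge-contexts Γ′ Δ′ E (mix (replace-∃ d qs₁) (replace-∃ e qs₂))
  replace-∃ (∃-r t d) (keep ∷ᵇ qs) = ∃-r t (replace-∃ d (keep ∷ᵇ qs))
  replace-∃ (∃-r t d) (_∷ᵇ_ {Γ′ = Γ′} (replace r) qs) = R-instance t Γ′ r (replace-∃ d (keep ∷ᵇ qs))
  replace-∃ {E} (∀-r d) (_∷ᵇ_ {Γ′ = Γ′} keep qs) =
    ∀-r (subst-tail (sym (map-++ shift Γ′ E))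
      (replace-∃ d (keep ∷ᵇ Blockwise-map shift Replace-shift qs)))
  replace-∃ {E} (ctr d) (_∷ᵇ_ {L = L} {Γ′ = Γ′} q qs) =
    subst ⊢_ (sym (++-assoc L Γ′ E)) (ctr-++ L (subst ⊢_ reassoc (replace-∃ d (q ∷ᵇ q ∷ᵇ qs))))
    where
    reassoc : (L ++ L ++ Γ′) ++ E ≡ L ++ L ++ Γ′ ++ E
    reassoc = trans (++-assoc L (L ++ Γ′) E) (cong (L ++_) (++-assoc L Γ′ E))
  replace-∃ {E} (wk d) (_∷ᵇ_ {L = L} {Γ′ = Γ′} q qs) =
    subst ⊢_ (sym (++-assoc L Γ′ E)) (wk-++ˡ L (replace-∃ d qs))
  replace-∃ {E} (exch p d) qs with Blockwise-↭ p qs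
  ... | Γ′ , qs′ , p′ = exch (++⁺ʳ E p′) (replace-∃ d qs′)

  replace-head-∃ : ∀ {E A Y Γ} → R E A Y → ⊢ (Ex A ∷ Γ) → ⊢ (Y ∷ Γ ++ E)
  replace-head-∃ {Γ = Γ} r d = replace-∃ d (replace r ∷ᵇ Blockwise-refl keep Γ)

Ex-vacuous : ∀ {B Γ} → ⊢ (Ex (shift B) ∷ Γ) → ⊢ (B ∷ Γ)
Ex-vacuous {Γ = Γ} d = subst-tail (++-identityʳ Γ) (replace-head-∃ vacuous d)
  where
  data Vacuous (E : List Formula) : Formula → Formula → Set where
    vacuous : ∀ {B} → Vacuous E (shift B) B

  Vacuous-shift : ∀ {E A Y} → Vacuous E A Y → Vacuous (map shift E) (ren (ext suc) A) (shift Y)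
  Vacuous-shift (vacuous {B}) = subst (λ A → Vacuous _ A (shift B)) (sym (ren-shift suc B)) vacuous

  Vacuous-instance : ∀ {E A Y} t Δ → Vacuous E A Y → ⊢ (A [ t ] ∷ Δ ++ E) → ⊢ (Y ∷ Δ ++ E)
  Vacuous-instance t Δ (vacuous {B}) = subst-head ([]-shift t B)

  open ExReplace Vacuous Vacuous-shift Vacuous-instance

Ex-∧-intro : ∀ {A B Γ} → ⊢ ((Ex A ∧ B) ∷ Γ) → ⊢ (Ex (A ∧ shift B) ∷ Γ)
Ex-∧-intro {Γ = Γ} d = ctr-++ʳ (_ ∷ []) Γ (replace-head-∃ (conjoin (∧-inversionʳ d)) (∧-inversionˡ d))
  where
  data Conjoin (E : List Formula) : Formula → Formula → Set where
    conjoin : ∀ {A B} → ⊢ (B ∷ E) → Conjoin E A (Ex (A ∧ shift B))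

  Conjoin-shift : ∀ {E A Y} → Conjoin E A Y → Conjoin (map shift E) (ren (ext suc) A) (shift Y)
  Conjoin-shift (conjoin {A} {B} e) =
    subst (λ C → Conjoin _ (ren (ext suc) A) (Ex (ren (ext suc) A ∧ C))) (sym (ren-shift suc B))
      (conjoin (ren-admissible suc e))

  Conjoin-instance : ∀ {E A Y} t Δ → Conjoin E A Y → ⊢ (A [ t ] ∷ Δ ++ E) → ⊢ (Y ∷ Δ ++ E)
  Conjoin-instance {E} {A} t Δ (conjoin {B = B} e) d =
    ∃-r t (subst-head (cong (A [ t ] ∧_) (sym ([]-shift t B)))
      (ctr-++ʳ (_ ∷ Δ) E (subst-tail (++-assoc Δ E E) (∧-r d e))))

  open ExReplace Conjoin Conjoin-shift Conjoin-instance

ren-ext²-swap01 : ∀ A → ren (ext (ext suc)) (ren swap01 A) ≡ ren swap01 (ren (ext (ext suc)) A)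
ren-ext²-swap01 A = trans (ren-ren _ _ A) (trans (ren-cong commute A) (sym (ren-ren _ _ A)))
  where
  commute : ext (ext suc) ∘ swap01 ≗ swap01 ∘ ext (ext suc)
  commute zero          = refl
  commute (suc zero)    = refl
  commute (suc (suc n)) = refl

ren-ext-suc-exts-single : ∀ t A →
  ren (ext suc) (sub (exts (single t)) A) ≡ sub (exts (single (renT suc t))) (ren (ext (ext suc)) A)
ren-ext-suc-exts-single t A = sym (sub-ren-comm commute A)
  where
  commute : exts (single (renT suc t)) ∘ ext (ext suc) ≗ renT (ext suc) ∘ exts (single t)
  commute zero          = refl
  commute (suc zero)    = trans (renT-renT suc suc t) (sym (renT-renT (ext suc) suc t))
  commute (suc (suc n)) = refl

[]-[]-swap01 : ∀ t u A → sub (exts (single u)) (ren swap01 A) [ t ] ≡ sub (exts (single t)) A [ u ]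
[]-[]-swap01 t u A = trans (cong (_[ t ]) (sub-ren (exts (single u)) swap01 A)) (sub-sub-≗ swapped A)
  where
  swapped : subT (single t) ∘ exts (single u) ∘ swap01 ≗ subT (single u) ∘ exts (single t)
  swapped zero          = subT-single-renT-suc t u
  swapped (suc zero)    = sym (subT-single-renT-suc u t)
  swapped (suc (suc n)) = refl

Ex-swap-admissible : ∀ {A Γ} → ⊢ (Ex (Ex A) ∷ Γ) → ⊢ (Ex (Ex (ren swap01 A)) ∷ Γ)
Ex-swap-admissible {Γ = Γ} d = subst-tail (++-identityʳ Γ) (O.replace-head-∃ outer d)
  where
  data Inner (E : List Formula) : Formula → Formula → Set where
    inner : ∀ {A} t → Inner E (sub (exts (single t)) A) (Ex (Ex (ren swap01 A)))

  Inner-shift : ∀ {E A Y} → Inner E A Y → Inner (map shift E) (ren (ext suc) A) (shift Y)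
  Inner-shift (inner {A} t) =
    subst₂ (Inner _) (sym (ren-ext-suc-exts-single t A)) (cong (Ex ∘ Ex) (sym (ren-ext²-swap01 A)))
      (inner (renT suc t))

  Inner-instance : ∀ {E A Y} u Δ → Inner E A Y → ⊢ (A [ u ] ∷ Δ ++ E) → ⊢ (Y ∷ Δ ++ E)
  Inner-instance u Δ (inner {A} t) d = ∃-r u (∃-r t (subst-head (sym ([]-[]-swap01 t u A)) d))

  module I = ExReplace Inner Inner-shift Inner-instance

  data Outer (E : List Formula) : Formula → Formula → Set where
    outer : ∀ {A} → Outer E (Ex A) (Ex (Ex (ren swap01 A)))

  Outer-shift : ∀ {E A Y} → Outer E A Y → Outer (map shift E) (ren (ext suc) A) (shift Y)
  Outer-shift (outer {A}) =
    subst (λ C → Outer _ (ren (ext suc) (Ex A)) (Ex (Ex C))) (sym (ren-ext²-swap01 A)) outer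

  Outer-instance : ∀ {E A Y} t Δ → Outer E A Y → ⊢ (A [ t ] ∷ Δ ++ E) → ⊢ (Y ∷ Δ ++ E)
  Outer-instance t Δ outer d =
    subst-tail (++-identityʳ (Δ ++ _)) (I.replace-head-∃ (inner t) d)

  module O = ExReplace Outer Outer-shift Outer-instance

-- From KS1 to LK1

infix 4 _⊑_

-- Closure under substitution lets ⊑ pass under ∀ (whose premise shifts the context)
-- and under ∃ (whose premise instantiates the bound variable).
_⊑_ : Formula → Formula → Set
X ⊑ Y = ∀ σ Γ → ⊢ (sub σ X ∷ Γ) → ⊢ (sub σ Y ∷ Γ)

⊑-refl : ∀ {X} → X ⊑ X
⊑-refl σ Γ d = d

⊑-trans : ∀ {X Y Z} → X ⊑ Y → Y ⊑ Z → X ⊑ Z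
⊑-trans h k σ Γ d = k σ Γ (h σ Γ d)

∨-monoˡ-⊑ : ∀ {X Y B} → X ⊑ Y → (X ∨ B) ⊑ (Y ∨ B)
∨-monoˡ-⊑ {B = B} h σ Γ d = ∨-r (h σ (sub σ B ∷ Γ) (∨-inversion d))

∨-monoʳ-⊑ : ∀ {X Y B} → X ⊑ Y → (B ∨ X) ⊑ (B ∨ Y)
∨-monoʳ-⊑ {B = B} h σ Γ d = ∨-r (exch-swap (h σ (sub σ B ∷ Γ) (exch-swap (∨-inversion d))))

∧-monoˡ-⊑ : ∀ {X Y B} → X ⊑ Y → (X ∧ B) ⊑ (Y ∧ B)
∧-monoˡ-⊑ h σ Γ d = ∧-r-shared (h σ Γ (∧-inversionˡ d)) (∧-inversionʳ d)

∧-monoʳ-⊑ : ∀ {X Y B} → X ⊑ Y → (B ∧ X) ⊑ (B ∧ Y)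
∧-monoʳ-⊑ h σ Γ d = ∧-r-shared (∧-inversionˡ d) (h σ Γ (∧-inversionʳ d))

All-mono-⊑ : ∀ {X Y} → X ⊑ Y → All X ⊑ All Y
All-mono-⊑ h σ Γ d = ∀-r (h (exts σ) (map shift Γ) (∀-inversion d))

Ex-mono-⊑ : ∀ {X Y} → X ⊑ Y → Ex X ⊑ Ex Y
Ex-mono-⊑ {X} {Y} h σ Γ d = subst-tail (++-identityʳ Γ) (replace-head-∃ (at (exts σ)) d)
  where
  data Substituted (E : List Formula) : Formula → Formula → Set where
    at : ∀ τ → Substituted E (sub τ X) (Ex (sub τ Y))

  Substituted-shift : ∀ {E A Z} → Substituted E A Z →
                      Substituted (map shift E) (ren (ext suc) A) (shift Z)
  Substituted-shift (at τ) =
    subst₂ (Substituted _) (sym (ren-sub (ext suc) τ X)) (cong Ex (sym (ren-sub (ext suc) τ Y)))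
      (at (renT (ext suc) ∘ τ))

  Substituted-instance : ∀ {E A Z} t Δ → Substituted E A Z →
                         ⊢ (A [ t ] ∷ Δ ++ E) → ⊢ (Z ∷ Δ ++ E)
  Substituted-instance t Δ (at τ) d =
    ∃-r t (subst-head (sym (sub-sub (single t) τ Y))
      (h (subT (single t) ∘ τ) _ (subst-head (sub-sub (single t) τ X) d)))

  open ExReplace Substituted Substituted-shift Substituted-instance

plug-mono-⊑ : ∀ S {P C} → P ⊑ C → plug S P ⊑ plug S C
plug-mono-⊑ hole     h = h
plug-mono-⊑ (S ∧ₗ B) h = ∧-monoˡ-⊑ (plug-mono-⊑ S h)
plug-mono-⊑ (B ∧ᵣ S) h = ∧-monoʳ-⊑ (plug-mono-⊑ S h)
plug-mono-⊑ (S ∨ₗ B) h = ∨-monoˡ-⊑ (plug-mono-⊑ S h)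
plug-mono-⊑ (B ∨ᵣ S) h = ∨-monoʳ-⊑ (plug-mono-⊑ S h)
plug-mono-⊑ (Exᶜ S)  h = Ex-mono-⊑ (plug-mono-⊑ S h)
plug-mono-⊑ (Allᶜ S) h = All-mono-⊑ (plug-mono-⊑ S h)

switch-admissible : ∀ {A B C Γ} → ⊢ ((A ∧ (B ∨ C)) ∷ Γ) → ⊢ (((A ∧ B) ∨ C) ∷ Γ)
switch-admissible {Γ = Γ} d = ∨-r (ctr-pair Γ (∧-r (∧-inversionˡ d) (∨-inversion (∧-inversionʳ d))))

mix-admissible : ∀ {A B Γ} → ⊢ ((A ∧ B) ∷ Γ) → ⊢ ((A ∨ B) ∷ Γ)
mix-admissible {Γ = Γ} d = ∨-r (ctr-pair Γ (mix (∧-inversionˡ d) (∧-inversionʳ d)))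

∨-wkʳ-admissible : ∀ {A B Γ} → ⊢ (A ∷ Γ) → ⊢ ((A ∨ B) ∷ Γ)
∨-wkʳ-admissible d = ∨-r (exch-swap (wk d))

∨-wkˡ-admissible : ∀ {A B Γ} → ⊢ (B ∷ Γ) → ⊢ ((A ∨ B) ∷ Γ)
∨-wkˡ-admissible d = ∨-r (wk d)

medial-admissible : ∀ {A B C D Γ} → ⊢ (((A ∧ C) ∨ (B ∧ D)) ∷ Γ) → ⊢ (((A ∨ B) ∧ (C ∨ D)) ∷ Γ)
medial-admissible d = ∧-r-shared
  (∨-r (exch-swap (∧-inversionˡ (exch-swap (∧-inversionˡ (∨-inversion d))))))
  (∨-r (exch-swap (∧-inversionʳ (exch-swap (∧-inversionʳ (∨-inversion d))))))

∨-idempotent : ∀ {A Γ} → ⊢ ((A ∨ A) ∷ Γ) → ⊢ (A ∷ Γ)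
∨-idempotent d = ctr (∨-inversion d)

All-medial-admissible : ∀ {A B Γ} → ⊢ ((All A ∨ All B) ∷ Γ) → ⊢ (All (A ∨ B) ∷ Γ)
All-medial-admissible d =
  ∀-r (∨-r (exch-swap (shift-All-inversion (exch-swap (∀-inversion (∨-inversion d))))))

All-contract-admissible : ∀ {A Γ} → ⊢ (All (All (ren (ext suc) A)) ∷ Γ) → ⊢ (All A ∷ Γ)
All-contract-admissible {A} d =
  subst-head (cong All (sub-ren-cancel (λ { zero → refl ; (suc n) → refl }) A)) (∀-instance (var zero) d)

∧-comm-admissible : ∀ {A B Γ} → ⊢ ((A ∧ B) ∷ Γ) → ⊢ ((B ∧ A) ∷ Γ)
∧-comm-admissible d = ∧-r-shared (∧-inversionʳ d) (∧-inversionˡ d)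

∨-comm-admissible : ∀ {A B Γ} → ⊢ ((A ∨ B) ∷ Γ) → ⊢ ((B ∨ A) ∷ Γ)
∨-comm-admissible d = ∨-r (exch-swap (∨-inversion d))

∧-assoc-admissible : ∀ {A B C Γ} → ⊢ (((A ∧ B) ∧ C) ∷ Γ) → ⊢ ((A ∧ (B ∧ C)) ∷ Γ)
∧-assoc-admissible d = ∧-r-shared (∧-inversionˡ (∧-inversionˡ d))
  (∧-r-shared (∧-inversionʳ (∧-inversionˡ d)) (∧-inversionʳ d))

∧-assoc⁻¹-admissible : ∀ {A B C Γ} → ⊢ ((A ∧ (B ∧ C)) ∷ Γ) → ⊢ (((A ∧ B) ∧ C) ∷ Γ)
∧-assoc⁻¹-admissible d = ∧-r-shared
  (∧-r-shared (∧-inversionˡ d) (∧-inversionˡ (∧-inversionʳ d))) (∧-inversionʳ (∧-inversionʳ d))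

∨-assoc-admissible : ∀ {A B C Γ} → ⊢ (((A ∨ B) ∨ C) ∷ Γ) → ⊢ ((A ∨ (B ∨ C)) ∷ Γ)
∨-assoc-admissible d =
  ∨-r (exch-swap (∨-r (exch (↭-sym (↭-shift _ (_ ∷ _ ∷ []) _)) (∨-inversion (∨-inversion d)))))

∨-assoc⁻¹-admissible : ∀ {A B C Γ} → ⊢ ((A ∨ (B ∨ C)) ∷ Γ) → ⊢ (((A ∨ B) ∨ C) ∷ Γ)
∨-assoc⁻¹-admissible d =
  ∨-r (∨-r (exch (↭-shift _ (_ ∷ _ ∷ []) _) (∨-inversion (exch-swap (∨-inversion d)))))

map-shift²-swap01 : ∀ Γ → map (ren swap01) (map shift (map shift Γ)) ≡ map shift (map shift Γ)
map-shift²-swap01 []      = refl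
map-shift²-swap01 (X ∷ Γ) = cong₂ _∷_ shift²-swap01 (map-shift²-swap01 Γ)
  where
  shift²-swap01 : ren swap01 (shift (shift X)) ≡ shift (shift X)
  shift²-swap01 = trans (cong (ren swap01) (ren-ren suc suc X))
    (trans (ren-ren swap01 (suc ∘ suc) X) (sym (ren-ren suc suc X)))

All-swap-admissible : ∀ {A Γ} → ⊢ (All (All A) ∷ Γ) → ⊢ (All (All (ren swap01 A)) ∷ Γ)
All-swap-admissible {Γ = Γ} d = ∀-r (∀-r (subst-tail (map-shift²-swap01 Γ)
  (ren-admissible swap01 (∀-inversion (∀-inversion d)))))

All-∨-admissible : ∀ {A B Γ} → ⊢ (All (A ∨ shift B) ∷ Γ) → ⊢ ((All A ∨ B) ∷ Γ)
All-∨-admissible d = ∨-r (∀-r (∨-inversion (∀-inversion d)))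

∨-All-admissible : ∀ {A B Γ} → ⊢ ((All A ∨ B) ∷ Γ) → ⊢ (All (A ∨ shift B) ∷ Γ)
∨-All-admissible d = ∀-r (∨-r (∀-inversion (∨-inversion d)))

Ex-∧-⊑ : ∀ {A B} → Ex (A ∧ shift B) ⊑ (Ex A ∧ B)
Ex-∧-⊑ {A} {B} σ Γ d = ∧-r-shared
  (Ex-mono-⊑ {A ∧ shift B} {A} (λ _ _ → ∧-inversionˡ) σ Γ d)
  (Ex-vacuous (subst-head (cong Ex (sub-shift σ B))
    (Ex-mono-⊑ {A ∧ shift B} {shift B} (λ _ _ → ∧-inversionʳ) σ Γ d)))

∧-Ex-⊑ : ∀ {A B} → (Ex A ∧ B) ⊑ Ex (A ∧ shift B)
∧-Ex-⊑ {A} {B} σ Γ d = subst-head (cong (λ C → Ex (_ ∧ C)) (sym (sub-shift σ B))) (Ex-∧-intro d)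

All-∨-⊑ : ∀ {A B} → All (A ∨ shift B) ⊑ (All A ∨ B)
All-∨-⊑ {B = B} σ Γ d = All-∨-admissible (subst-head (cong (λ C → All (_ ∨ C)) (sub-shift σ B)) d)

∨-All-⊑ : ∀ {A B} → (All A ∨ B) ⊑ All (A ∨ shift B)
∨-All-⊑ {B = B} σ Γ d =
  subst-head (cong (λ C → All (_ ∨ C)) (sym (sub-shift σ B))) (∨-All-admissible d)

swap01-⊑ : ∀ (Q : Formula → Formula) →
           (∀ {A Γ} → ⊢ (Q (Q A) ∷ Γ) → ⊢ (Q (Q (ren swap01 A)) ∷ Γ)) →
           (∀ σ A → sub σ (Q (Q A)) ≡ Q (Q (sub (exts (exts σ)) A))) →
           ∀ {A} → (Q (Q A) ⊑ Q (Q (ren swap01 A))) × (Q (Q (ren swap01 A)) ⊑ Q (Q A))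
swap01-⊑ Q admissible sub-Q² {A} = forward , backward
  where
  forward : Q (Q A) ⊑ Q (Q (ren swap01 A))
  forward σ Γ d = subst-head (trans (cong (Q ∘ Q) (sym (sub-ren-swap01 σ A))) (sym (sub-Q² σ _)))
    (admissible (subst-head (sub-Q² σ A) d))

  backward : Q (Q (ren swap01 A)) ⊑ Q (Q A)
  backward σ Γ d = subst-head (trans (cong (Q ∘ Q) (ren-swap01-involutive _)) (sym (sub-Q² σ A)))
    (admissible (subst-head (trans (sub-Q² σ _) (cong (Q ∘ Q) (sub-ren-swap01 σ A))) d))

≅-sound : ∀ {A B} → A ≅ B → (A ⊑ B) × (B ⊑ A)
≅-sound refl≅ = ⊑-refl , ⊑-refl
≅-sound (sym≅ e) = proj₂ (≅-sound e) , proj₁ (≅-sound e)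
≅-sound (trans≅ e f) =
  ⊑-trans (proj₁ (≅-sound e)) (proj₁ (≅-sound f)) , ⊑-trans (proj₂ (≅-sound f)) (proj₂ (≅-sound e))
≅-sound (cong∧ e f) =
  ⊑-trans (∧-monoˡ-⊑ (proj₁ (≅-sound e))) (∧-monoʳ-⊑ (proj₁ (≅-sound f))) ,
  ⊑-trans (∧-monoˡ-⊑ (proj₂ (≅-sound e))) (∧-monoʳ-⊑ (proj₂ (≅-sound f)))
≅-sound (cong∨ e f) =
  ⊑-trans (∨-monoˡ-⊑ (proj₁ (≅-sound e))) (∨-monoʳ-⊑ (proj₁ (≅-sound f))) ,
  ⊑-trans (∨-monoˡ-⊑ (proj₂ (≅-sound e))) (∨-monoʳ-⊑ (proj₂ (≅-sound f)))
≅-sound (congEx e)  = Ex-mono-⊑ (proj₁ (≅-sound e)) , Ex-mono-⊑ (proj₂ (≅-sound e))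
≅-sound (congAll e) = All-mono-⊑ (proj₁ (≅-sound e)) , All-mono-⊑ (proj₂ (≅-sound e))
≅-sound ∧-comm   = (λ _ _ → ∧-comm-admissible) , (λ _ _ → ∧-comm-admissible)
≅-sound ∨-comm   = (λ _ _ → ∨-comm-admissible) , (λ _ _ → ∨-comm-admissible)
≅-sound ∧-assoc  = (λ _ _ → ∧-assoc-admissible) , (λ _ _ → ∧-assoc⁻¹-admissible)
≅-sound ∨-assoc  = (λ _ _ → ∨-assoc-admissible) , (λ _ _ → ∨-assoc⁻¹-admissible)
≅-sound All-swap = swap01-⊑ All All-swap-admissible (λ _ _ → refl)
≅-sound Ex-swap  = swap01-⊑ Ex Ex-swap-admissible (λ _ _ → refl)
≅-sound All-∨    = All-∨-⊑ , ∨-All-⊑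
≅-sound Ex-∧     = Ex-∧-⊑ , ∧-Ex-⊑

rule-sound : ∀ {P C} → P ⟶ C → P ⊑ C
rule-sound ∀-rule σ Γ d = wk-++ʳ Γ (∀-r t-r)
rule-sound (ai a) σ Γ d = wk-++ʳ Γ (∨-r (ax-subA σ a))
rule-sound t-rule σ Γ d = subst-tail (++-identityʳ Γ) (∧-r d t-r)
rule-sound s σ Γ = switch-admissible
rule-sound mixᵏ σ Γ = mix-admissible
rule-sound (∃-rule {A} t) σ Γ d = ∃-r (subT σ t) (subst-head (sub-[] σ t A) d)
rule-sound (≡-rule e) = proj₂ (≅-sound e)
rule-sound w σ Γ = ∨-wkʳ-admissible
rule-sound m σ Γ = medial-admissible
rule-sound (ac a) σ Γ = ∨-idempotent
rule-sound m∀ σ Γ = All-medial-admissible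
rule-sound (m∃ {A} {B}) σ Γ d =
  ctr (Ex-mono-⊑ {B} {A ∨ B} (λ _ _ → ∨-wkˡ-admissible) σ _
    (exch-swap (Ex-mono-⊑ {A} {A ∨ B} (λ _ _ → ∨-wkʳ-admissible) σ _ (∨-inversion d))))
rule-sound (w∀ {A}) σ Γ d = subst-head (cong All (sym (sub-shift σ A))) (∀-r (ren-admissible suc d))
rule-sound (c∀ {A}) σ Γ d =
  All-contract-admissible (subst-head (cong (All ∘ All) (sub-ren-ext-suc σ A)) d)

KS1-sound : ∀ {X Y} → Star KS1-step X Y → X ⊑ Y
KS1-sound ε              = ⊑-refl
KS1-sound (step S r ◅ p) = ⊑-trans (plug-mono-⊑ S (rule-sound r)) (KS1-sound p)

⋁-inversion : ∀ A Γ {Δ} → ⊢ (⋁ A Γ ∷ Δ) → ⊢ (A ∷ Γ ++ Δ)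
⋁-inversion A []      d = d
⋁-inversion A (B ∷ Γ) {Δ} d = exch (↭-shift A (B ∷ Γ) Δ) (⋁-inversion B Γ (exch-swap (∨-inversion d)))

KS1⇒LK1 : ∀ A Γ → KS1-provable (⋁ A Γ) → ⊢ (A ∷ Γ)
KS1⇒LK1 A Γ p = subst-tail (++-identityʳ Γ)
  (⋁-inversion A Γ (subst-head (sub-var (⋁ A Γ)) (KS1-sound p var [] t-r)))

-- From LK1 to KS1

KS1-derivation : Formula → Formula → Set
KS1-derivation = Star KS1-step

infixr 6 _⊚_

_⊚_ : Ctx → Ctx → Ctx
hole     ⊚ T = T
(S ∧ₗ B) ⊚ T = (S ⊚ T) ∧ₗ B
(B ∧ᵣ S) ⊚ T = B ∧ᵣ (S ⊚ T)
(S ∨ₗ B) ⊚ T = (S ⊚ T) ∨ₗ B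
(B ∨ᵣ S) ⊚ T = B ∨ᵣ (S ⊚ T)
Exᶜ S    ⊚ T = Exᶜ (S ⊚ T)
Allᶜ S   ⊚ T = Allᶜ (S ⊚ T)

plug-⊚ : ∀ S T X → plug (S ⊚ T) X ≡ plug S (plug T X)
plug-⊚ hole     T X = refl
plug-⊚ (S ∧ₗ B) T X = cong (_∧ B) (plug-⊚ S T X)
plug-⊚ (B ∧ᵣ S) T X = cong (B ∧_) (plug-⊚ S T X)
plug-⊚ (S ∨ₗ B) T X = cong (_∨ B) (plug-⊚ S T X)
plug-⊚ (B ∨ᵣ S) T X = cong (B ∨_) (plug-⊚ S T X)
plug-⊚ (Exᶜ S)  T X = cong Ex (plug-⊚ S T X)
plug-⊚ (Allᶜ S) T X = cong All (plug-⊚ S T X)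

in-ctx : ∀ S {X Y} → KS1-derivation X Y → KS1-derivation (plug S X) (plug S Y)
in-ctx S ε = ε
in-ctx S (step T {P} {C} r ◅ p) =
  subst₂ KS1-step (plug-⊚ S T P) (plug-⊚ S T C) (step (S ⊚ T) r) ◅ in-ctx S p

by : ∀ {P C} → P ⟶ C → KS1-derivation P C
by r = step hole r ◅ ε

by-≅ : ∀ {A B} → A ≅ B → KS1-derivation B A
by-≅ e = by (≡-rule e)

∨-contraction : ∀ A → KS1-derivation (A ∨ A) A
∨-contraction (atom a) = by (ac a)
∨-contraction (A ∧ B) =
  by m ◅◅ in-ctx (hole ∧ₗ (B ∨ B)) (∨-contraction A) ◅◅ in-ctx (A ∧ᵣ hole) (∨-contraction B)
∨-contraction (A ∨ B) =
  by-≅ regroup ◅◅ in-ctx (hole ∨ₗ (B ∨ B)) (∨-contraction A)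
               ◅◅ in-ctx (A ∨ᵣ hole) (∨-contraction B)
  where
  regroup : ((A ∨ A) ∨ (B ∨ B)) ≅ ((A ∨ B) ∨ (A ∨ B))
  regroup = trans≅ ∨-assoc (trans≅ (cong∨ refl≅ (sym≅ ∨-assoc))
    (trans≅ (cong∨ refl≅ (cong∨ ∨-comm refl≅)) (trans≅ (cong∨ refl≅ ∨-assoc) (sym≅ ∨-assoc))))
∨-contraction (Ex A)  = by m∃ ◅◅ in-ctx (Exᶜ hole) (∨-contraction A)
∨-contraction (All A) = by m∀ ◅◅ in-ctx (Allᶜ hole) (∨-contraction A)

⋁-++ : ∀ C Γ D Δ → ⋁ C (Γ ++ D ∷ Δ) ≅ (⋁ C Γ ∨ ⋁ D Δ)
⋁-++ C []      D Δ = refl≅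
⋁-++ C (E ∷ Γ) D Δ = trans≅ (cong∨ refl≅ (⋁-++ E Γ D Δ)) (sym≅ ∨-assoc)

mutual
  ⋁-cong-↭ : ∀ C {Γ Δ} → Γ ↭ Δ → ⋁ C Γ ≅ ⋁ C Δ
  ⋁-cong-↭ C {[]}    {[]}    p = refl≅
  ⋁-cong-↭ C {[]}    {_ ∷ _} p = ⊥-elim (¬x∷xs↭[] (↭-sym p))
  ⋁-cong-↭ C {_ ∷ _} {[]}    p = ⊥-elim (¬x∷xs↭[] p)
  ⋁-cong-↭ C {_ ∷ _} {_ ∷ _} p = cong∨ refl≅ (⋁-↭ p)

  ⋁-↭ : ∀ {A B Γ Δ} → A ∷ Γ ↭ B ∷ Δ → ⋁ A Γ ≅ ⋁ B Δ
  ⋁-↭ Perm.refl = refl≅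
  ⋁-↭ (prep A p) = ⋁-cong-↭ A p
  ⋁-↭ (swap {[]} {[]} A B p) = ∨-comm
  ⋁-↭ (swap {[]} {_ ∷ _} A B p) = ⊥-elim (¬x∷xs↭[] (↭-sym p))
  ⋁-↭ (swap {_ ∷ _} {[]} A B p) = ⊥-elim (¬x∷xs↭[] p)
  ⋁-↭ (swap {_ ∷ _} {_ ∷ _} A B p) =
    trans≅ (cong∨ refl≅ (cong∨ refl≅ (⋁-↭ p)))
      (trans≅ (sym≅ ∨-assoc) (trans≅ (cong∨ ∨-comm refl≅) ∨-assoc))
  ⋁-↭ (Perm.trans {ys = []}    p q) = ⊥-elim (¬x∷xs↭[] p)
  ⋁-↭ (Perm.trans {ys = _ ∷ _} p q) = trans≅ (⋁-↭ p) (⋁-↭ q)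

⋁-shift : ∀ C Γ → ⋁ (shift C) (map shift Γ) ≡ shift (⋁ C Γ)
⋁-shift C []      = refl
⋁-shift C (D ∷ Γ) = cong (shift C ∨_) (⋁-shift D Γ)

∧-derivation : ∀ {X Y} → KS1-provable X → KS1-provable Y → KS1-provable (X ∧ Y)
∧-derivation {X} p q = by t-rule ◅◅ in-ctx (hole ∧ₗ 𝕥) p ◅◅ in-ctx (X ∧ᵣ hole) q

switchˡ : ∀ {A B C} → KS1-derivation ((A ∨ C) ∧ B) ((A ∧ B) ∨ C)
switchˡ = by-≅ ∧-comm ◅◅ by s ◅◅ in-ctx (hole ∨ₗ _) (by-≅ ∧-comm)

⋁-∧ : ∀ A Γ B Δ → KS1-derivation (⋁ A Γ ∧ ⋁ B Δ) (⋁ (A ∧ B) (Γ ++ Δ))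
⋁-∧ A []      B []      = ε
⋁-∧ A []      B (D ∷ Δ) = by s
⋁-∧ A (C ∷ Γ) B []      =
  subst (λ Θ → KS1-derivation ((A ∨ ⋁ C Γ) ∧ B) ((A ∧ B) ∨ ⋁ C Θ)) (sym (++-identityʳ Γ)) switchˡ
⋁-∧ A (C ∷ Γ) B (D ∷ Δ) =
  by s ◅◅ in-ctx (hole ∨ₗ _) switchˡ ◅◅ by-≅ (sym≅ ∨-assoc)
       ◅◅ in-ctx ((A ∧ B) ∨ᵣ hole) (by-≅ (⋁-++ C Γ D Δ))

⋁-provable : Sequent → Set
⋁-provable []      = ⊥
⋁-provable (A ∷ Γ) = KS1-provable (⋁ A Γ)

LK1⇒KS1 : ∀ {Γ} → ⊢ Γ → ⋁-provable Γ
LK1⇒KS1 (ax a) = by (ai a)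
LK1⇒KS1 (∨-r {[]} d) = LK1⇒KS1 d
LK1⇒KS1 (∨-r {C ∷ Γ} d) = LK1⇒KS1 d ◅◅ by-≅ ∨-assoc
LK1⇒KS1 (∧-r {Γ} {Δ} {A} {B} d e) = ∧-derivation (LK1⇒KS1 d) (LK1⇒KS1 e) ◅◅ ⋁-∧ A Γ B Δ
LK1⇒KS1 t-r = ε
LK1⇒KS1 (f-r {[]} d) = ⊥-elim (LK1⇒KS1 d)
LK1⇒KS1 (f-r {C ∷ Γ} d) = LK1⇒KS1 d ◅◅ by w ◅◅ by-≅ ∨-comm
LK1⇒KS1 (mix {[]} d e) = ⊥-elim (LK1⇒KS1 d)
LK1⇒KS1 (mix {C ∷ Γ} {[]} d e) = ⊥-elim (LK1⇒KS1 e)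
LK1⇒KS1 (mix {C ∷ Γ} {D ∷ Δ} d e) =
  ∧-derivation (LK1⇒KS1 d) (LK1⇒KS1 e) ◅◅ by mixᵏ ◅◅ by-≅ (⋁-++ C Γ D Δ)
LK1⇒KS1 (∃-r {[]} t d) = LK1⇒KS1 d ◅◅ by (∃-rule t)
LK1⇒KS1 (∃-r {C ∷ Γ} t d) = LK1⇒KS1 d ◅◅ in-ctx (hole ∨ₗ _) (by (∃-rule t))
LK1⇒KS1 (∀-r {[]} d) = by ∀-rule ◅◅ in-ctx (Allᶜ hole) (LK1⇒KS1 d)
LK1⇒KS1 (∀-r {C ∷ Γ} {A} d) =
  by ∀-rule ◅◅ in-ctx (Allᶜ hole) (subst (λ X → KS1-provable (A ∨ X)) (⋁-shift C Γ) (LK1⇒KS1 d))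
            ◅◅ by-≅ (sym≅ All-∨)
LK1⇒KS1 (ctr {[]} {A} d) = LK1⇒KS1 d ◅◅ ∨-contraction A
LK1⇒KS1 (ctr {C ∷ Γ} {A} d) = LK1⇒KS1 d ◅◅ by-≅ ∨-assoc ◅◅ in-ctx (hole ∨ₗ _) (∨-contraction A)
LK1⇒KS1 (wk {[]} d) = ⊥-elim (LK1⇒KS1 d)
LK1⇒KS1 (wk {C ∷ Γ} d) = LK1⇒KS1 d ◅◅ by w ◅◅ by-≅ ∨-comm
LK1⇒KS1 (exch {[]} p d) = ⊥-elim (LK1⇒KS1 d)
LK1⇒KS1 (exch {C ∷ Γ} {[]} p d) = ⊥-elim (¬x∷xs↭[] p)
LK1⇒KS1 (exch {C ∷ Γ} {D ∷ Δ} p d) = LK1⇒KS1 d ◅◅ by-≅ (sym≅ (⋁-↭ p))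

theorem7p5 : ∀ (A : Formula) (Γ : List Formula) → (⊢ (A ∷ Γ)) ⇔ KS1-provable (⋁ A Γ)
theorem7p5 A Γ = mk⇔ LK1⇒KS1 (KS1⇒LK1 A Γ)
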